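{- Let $\mathcal{D}\triangleleft x_1:\sigma_1,\dots,x_n:\sigma_n\vdash M:\sigma$ be a cut-free lazy derivation of $\mathsf{LEM}$. Then: (1) $M$ is a linear $\lambda$-term (containing no $\mathtt{discard}$ or $\mathtt{copy}$) in normal form; (2) $|M|\leq\sum_{i=1}^n|\sigma_i|+|\sigma|$; (3) $|\mathcal{D}|=|M|+k$, where $k$ is the number of occurrences of $\forall$ and $\S$ in $\sigma_1,\dots,\sigma_n,\sigma$; (4) if $\mathcal{D}'\triangleleft x_1:\sigma_1,\dots,x_n:\sigma_n\vdash N:\sigma$ is also a lazy cut-free derivation, then $|N|\leq|M|$ implies $|\mathcal{D}'|\leq|\mathcal{D}|$; (5) the set of values $V$ such that $\vdash V:\sigma$ is derivable is finite.
   Context: $\mathsf{LEM}$: linear types $A ::= \alpha \mid \sigma\multimap A \mid \forall\alpha.A$; types $\sigma ::= A \mid \S\sigma$, where in $\S\sigma$ the type $\sigma$ is closed with no negative occurrence of $\forall$ (standard polarity: in $\sigma\multimap A$ occurrences inside $\sigma$ reverse polarity; $\forall$ and $\S$ preserve it). Values are closed $\beta$-normal linear $\lambda$-terms. Terms: $x\mid\lambda x.M\mid MN\mid\mathtt{discard}_\sigma\,M\ \mathtt{in}\ N\mid\mathtt{copy}^V_\sigma\,M\ \mathtt{as}\ x,y\ \mathtt{in}\ N$ ($V$ a value), linear only. Typing rules: (ax) $x:A\vdash x:A$, $A$ linear; (cut) from $\Gamma\vdash N:\sigma$, $\Delta,x:\sigma\vdash M:\tau$ infer $\Gamma,\Delta\vdash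 M[N/x]:\tau$; ($\multimap$R) from $\Gamma,x:\sigma\vdash M:B$ infer $\Gamma\vdash\lambda x.M:\sigma\multimap B$; ($\multimap$L) from $\Gamma\vdash N:\sigma$, $\Delta,x:B\vdash M:\tau$ infer $\Gamma,\Delta,y:\sigma\multimap B\vdash M[yN/x]:\tau$; ($\forall$R) from $\Gamma\vdash M:A\langle\gamma/\alpha\rangle$, $\gamma$ not free in $\Gamma$, infer $\Gamma\vdash M:\forall\alpha.A$; ($\forall$L) from $\Gamma,x:A\langle B/\alpha\rangle\vdash M:\tau$ infer $\Gamma,x:\forall\alpha.A\vdash M:\tau$; ($p$) from $x_1:\S\sigma_1,\dots,x_n:\S\sigma_n\vdash M:\sigma$ infer the same context $\vdash M:\S\sigma$; ($d$) from $\Gamma,x:\sigma\vdash M:\tau$ infer $\Gamma,y:\S\sigma\vdash M[y/x]:\tau$; ($w$) from $\Gamma\vdash M:\tau$ infer $\Gamma,x:\S\sigma\vdash\mathtt{discard}_\sigma\,x\ \mathtt{in}\ M:\tau$; ($c$) from $\Gamma,y:\S\sigma,z:\S\sigma\vdash M:\tau$ and $\vdash V:\sigma$ infer $\Gamma,x:\S\sigma\vdash\mathtt{copy}^V_\sigma\,x\ \mathtt{as}\ y,z\ \mathtt{in}\ M:\tau$. Lazy type: no negative occurrence of $\forall$. Lazy judgment $x_1:\sigma_1,\dots,x_n:\sigma_n\vdash M:\tau$: $\tau$ lazy and no $\sigma_i$ has a positive occurrence of $\forall$; lazy derivation: its conclusion is lazy. Sizes: $|M|$ and $|\sigma|$ are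 the numbers of nodes of the syntax trees. Size of a derivation: $1$ for an axiom; $|\mathcal{D}'|+1$ for a one-premise rule; $|\mathcal{D}'|+|\mathcal{D}''|+1$ for a two-premise rule other than $c$; $|\mathcal{D}'|+|\mathcal{D}''|+3$ for $c$. -}

module Defs where

open import Data.Nat using (ℕ; zero; suc; _+_; _≤_)
open import Data.Fin using (Fin; zero; suc)
open import Data.Vec using (Vec; []; _∷_; map)
open import Data.Vec.Relation.Unary.All using (All)
open import Data.Product using (_×_; _,_)
open import Data.Empty using (⊥)
open import Data.Unit using (⊤)
open import Relation.Binary.PropositionalEquality using (_≡_)
import Relation.Nullary
import Data.Fin

data Pol : Set where
  pos neg : Pol

flip : Pol → Pol
flip pos = neg
flip neg = pos

-- Types of LEM, well-scoped de Bruijn: LTy t / Ty t have t free type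
-- variables.
--
-- NoAllL p A / NoAllT p σ : "no occurrence of ∀ of polarity p" (polarity
-- relative to the whole type; ⊸ reverses it in its argument, ∀ and §
-- preserve it).

data LTy : ℕ → Set
data Ty : ℕ → Set
data NoAllL : {t : ℕ} → Pol → LTy t → Set
data NoAllT : {t : ℕ} → Pol → Ty t → Set

data LTy where
  tv  : ∀ {t} → Fin t → LTy t
  _⊸_ : ∀ {t} → Ty t → LTy t → LTy t
  Π   : ∀ {t} → LTy (suc t) → LTy t

data Ty where
  lin : ∀ {t} → LTy t → Ty t
  §   : ∀ {t} (σ : Ty 0) → NoAllT neg σ → Ty t

data NoAllL where
  tv  : ∀ {t p} {i : Fin t} → NoAllL p (tv i)
  _⊸_ : ∀ {t p} {σ : Ty t} {A : LTy t} →
        NoAllT (flip p) σ → NoAllL p A → NoAllL p (σ ⊸ A)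
  Π   : ∀ {t} {A : LTy (suc t)} → NoAllL neg A → NoAllL neg (Π A)
  -- the outermost ∀ of Π A is a positive occurrence, so NoAllL pos (Π A) has no proof

data NoAllT where
  lin : ∀ {t p} {A : LTy t} → NoAllL p A → NoAllT p (lin A)
  §   : ∀ {t p} {σ : Ty 0} {h : NoAllT neg σ} → NoAllT p σ → NoAllT {t} p (§ σ h)

LazyTy : ∀ {t} → Ty t → Set
LazyTy σ = NoAllT neg σ

extR : ∀ {n m} → (Fin n → Fin m) → Fin (suc n) → Fin (suc m)
extR ρ zero    = zero
extR ρ (suc i) = suc (ρ i)

renL : ∀ {n m} → (Fin n → Fin m) → LTy n → LTy m
renT : ∀ {n m} → (Fin n → Fin m) → Ty n → Ty m
renL ρ (tv i)  = tv (ρ i)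
renL ρ (σ ⊸ A) = renT ρ σ ⊸ renL ρ A
renL ρ (Π A)   = Π (renL (extR ρ) A)
renT ρ (lin A)   = lin (renL ρ A)
renT ρ (§ σ h)   = § σ h

extS : ∀ {n m} → (Fin n → LTy m) → Fin (suc n) → LTy (suc m)
extS s zero    = tv zero
extS s (suc i) = renL suc (s i)

substL : ∀ {n m} → (Fin n → LTy m) → LTy n → LTy m
substT : ∀ {n m} → (Fin n → LTy m) → Ty n → Ty m
substL s (tv i)  = s i
substL s (σ ⊸ A) = substT s σ ⊸ substL s A
substL s (Π A)   = Π (substL (extS s) A)
substT s (lin A) = lin (substL s A)
substT s (§ σ h) = § σ h

single : ∀ {t} → LTy t → Fin (suc t) → LTy t
single B zero    = B
single B (suc i) = tv i

_⟨_⟩ : ∀ {t} → LTy (suc t) → LTy t → LTy t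
A ⟨ B ⟩ = substL (single B) A

emb : ∀ {t} → Ty 0 → Ty t
emb = renT (λ ())

-- Terms (well-scoped de Bruijn, k free term variables)
--   x | λx.M | M N | discard_σ M in N | copy^V_σ M as x,y in N
-- (in copy, N binds x = 0 and y = 1)

data Tm : ℕ → Set where
  var     : ∀ {k} → Fin k → Tm k
  lam     : ∀ {k} → Tm (suc k) → Tm k
  app     : ∀ {k} → Tm k → Tm k → Tm k
  discard : ∀ {k} → Ty 0 → Tm k → Tm k → Tm k
  copy    : ∀ {k} → Ty 0 → Tm 0 → Tm k → Tm (suc (suc k)) → Tm k

renTm : ∀ {n m} → (Fin n → Fin m) → Tm n → Tm m
renTm ρ (var i)         = var (ρ i)
renTm ρ (lam M)         = lam (renTm (extR ρ) M)
renTm ρ (app M N)       = app (renTm ρ M) (renTm ρ N)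
renTm ρ (discard σ M N) = discard σ (renTm ρ M) (renTm ρ N)
renTm ρ (copy σ V M N)  = copy σ V (renTm ρ M) (renTm (extR (extR ρ)) N)

extTm : ∀ {n m} → (Fin n → Tm m) → Fin (suc n) → Tm (suc m)
extTm s zero    = var zero
extTm s (suc i) = renTm suc (s i)

substTm : ∀ {n m} → (Fin n → Tm m) → Tm n → Tm m
substTm s (var i)         = s i
substTm s (lam M)         = lam (substTm (extTm s) M)
substTm s (app M N)       = app (substTm s M) (substTm s N)
substTm s (discard σ M N) = discard σ (substTm s M) (substTm s N)
substTm s (copy σ V M N)  = copy σ V (substTm s M) (substTm (extTm (extTm s)) N)

Pure : ∀ {k} → Tm k → Set
Pure (var i)         = ⊤
Pure (lam M)         = Pure M
Pure (app M N)       = Pure M × Pure N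
Pure (discard _ _ _) = ⊥
Pure (copy _ _ _ _)  = ⊥

NotLam : ∀ {k} → Tm k → Set
NotLam (lam _) = ⊥
NotLam _       = ⊤

Normal : ∀ {k} → Tm k → Set
Normal (var i)         = ⊤
Normal (lam M)         = Normal M
Normal (app M N)       = NotLam M × Normal M × Normal N
Normal (discard σ M N) = Normal M × Normal N
Normal (copy σ V M N)  = Normal M × Normal N

occ : ∀ {k} → Fin k → Tm k → ℕ
occ i (var j) with i Data.Fin.≟ j
... | Relation.Nullary.yes _ = 1
... | Relation.Nullary.no _  = 0
occ i (lam M)         = occ (suc i) M
occ i (app M N)       = occ i M + occ i N
occ i (discard σ M N) = occ i M + occ i N
occ i (copy σ V M N)  = occ i M + occ (suc (suc i)) N

LamLinear : ∀ {k} → Tm k → Set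
LamLinear (var i)         = ⊤
LamLinear (lam M)         = (occ zero M ≡ 1) × LamLinear M
LamLinear (app M N)       = LamLinear M × LamLinear N
LamLinear (discard σ M N) = LamLinear M × LamLinear N
LamLinear (copy σ V M N)  = LamLinear M × LamLinear N

Linear : ∀ {k} → Tm k → Set
Linear M = (∀ i → occ i M ≤ 1) × LamLinear M

IsValue : Tm 0 → Set
IsValue V = Pure V × Normal V × Linear V

-- Contexts and context splitting (Θ is an interleaving of Γ and Δ;
-- this realises "Γ,Δ" with contexts read up to exchange)

Ctx : ℕ → ℕ → Set
Ctx t k = Vec (Ty t) k

data Split {t : ℕ} : ∀ {k l m} → Ctx t k → Ctx t l → Ctx t m → Set where
  []    : Split [] [] []
  left  : ∀ {k l m σ} {Θ : Ctx t k} {Γ : Ctx t l} {Δ : Ctx t m} →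
          Split Θ Γ Δ → Split (σ ∷ Θ) (σ ∷ Γ) Δ
  right : ∀ {k l m σ} {Θ : Ctx t k} {Γ : Ctx t l} {Δ : Ctx t m} →
          Split Θ Γ Δ → Split (σ ∷ Θ) Γ (σ ∷ Δ)

embL : ∀ {t k l m} {Θ : Ctx t k} {Γ : Ctx t l} {Δ : Ctx t m} → Split Θ Γ Δ → Fin l → Fin k
embL (left s)  zero    = zero
embL (left s)  (suc i) = suc (embL s i)
embL (right s) i       = suc (embL s i)

embR : ∀ {t k l m} {Θ : Ctx t k} {Γ : Ctx t l} {Δ : Ctx t m} → Split Θ Γ Δ → Fin m → Fin k
embR (left s)  i       = suc (embR s i)
embR (right s) zero    = zero
embR (right s) (suc i) = suc (embR s i)

ins : ∀ {t k m} {Θ : Ctx t k} {τ : Ty t} {Γ : Ctx t m} →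
      Split Θ (τ ∷ []) Γ → Fin (suc m) → Fin k
ins s zero    = embL s zero
ins s (suc i) = embR s i

ins2 : ∀ {t k m} {Θ : Ctx t k} {τ : Ty t} {Γ : Ctx t m} →
       Split Θ (τ ∷ []) Γ → Fin (suc (suc m)) → Fin (suc (suc k))
ins2 s zero          = zero
ins2 s (suc zero)    = suc zero
ins2 s (suc (suc i)) = suc (suc (embR s i))

-- M[N/x] for the cut rule (x = variable 0 of M)
cutSub : ∀ {t k l m} {Θ : Ctx t k} {Γ : Ctx t l} {Δ : Ctx t m} →
         Split Θ Γ Δ → Tm l → Fin (suc m) → Tm k
cutSub s N zero    = renTm (embL s) N
cutSub s N (suc i) = var (embR s i)

-- M[yN/x] for the ⊸L rule
arrSub : ∀ {t k k' l m} {Θ : Ctx t k} {τ : Ty t} {Θ' : Ctx t k'} {Γ : Ctx t l} {Δ : Ctx t m} →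
         Split Θ (τ ∷ []) Θ' → Split Θ' Γ Δ → Tm l → Fin (suc m) → Tm k
arrSub s₁ s₂ N zero    = app (var (embL s₁ zero)) (renTm (λ i → embR s₁ (embL s₂ i)) N)
arrSub s₁ s₂ N (suc i) = var (embR s₁ (embR s₂ i))

data IsBox {t : ℕ} : Ty t → Set where
  box : ∀ {σ h} → IsBox (§ σ h)

infix 3 _⊢_∶_

data _⊢_∶_ : ∀ {t k} → Ctx t k → Tm k → Ty t → Set where
  ax   : ∀ {t} {A : LTy t} → (lin A ∷ []) ⊢ var zero ∶ lin A
  cut  : ∀ {t k l m} {Θ : Ctx t k} {Γ : Ctx t l} {Δ : Ctx t m} {N M σ τ} →
         (s : Split Θ Γ Δ) → Γ ⊢ N ∶ σ → (σ ∷ Δ) ⊢ M ∶ τ →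
         Θ ⊢ substTm (cutSub s N) M ∶ τ
  ⊸R   : ∀ {t k} {Γ : Ctx t k} {σ M B} →
         (σ ∷ Γ) ⊢ M ∶ lin B → Γ ⊢ lam M ∶ lin (σ ⊸ B)
  ⊸L   : ∀ {t k k' l m} {Θ : Ctx t k} {Θ' : Ctx t k'} {Γ : Ctx t l} {Δ : Ctx t m}
           {N M σ B τ} →
         (s₁ : Split Θ (lin (σ ⊸ B) ∷ []) Θ') (s₂ : Split Θ' Γ Δ) →
         Γ ⊢ N ∶ σ → (lin B ∷ Δ) ⊢ M ∶ τ →
         Θ ⊢ substTm (arrSub s₁ s₂ N) M ∶ τ
  ∀R   : ∀ {t k} {Γ : Ctx t k} {M} {A : LTy (suc t)} →
         map (renT suc) Γ ⊢ M ∶ lin A → Γ ⊢ M ∶ lin (Π A)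
  ∀L   : ∀ {t k m} {Θ : Ctx t k} {Γ : Ctx t m} {M τ} {A : LTy (suc t)} {B : LTy t} →
         (s : Split Θ (lin (Π A) ∷ []) Γ) →
         (lin (A ⟨ B ⟩) ∷ Γ) ⊢ M ∶ τ → Θ ⊢ renTm (ins s) M ∶ τ
  prom : ∀ {t k} {Γ : Ctx t k} {M} {σ : Ty 0} {h : NoAllT neg σ} →
         All IsBox Γ → Γ ⊢ M ∶ emb σ → Γ ⊢ M ∶ § σ h
  der  : ∀ {t k m} {Θ : Ctx t k} {Γ : Ctx t m} {M τ} {σ : Ty 0} {h : NoAllT neg σ} →
         (s : Split Θ (§ σ h ∷ []) Γ) →
         (emb σ ∷ Γ) ⊢ M ∶ τ → Θ ⊢ renTm (ins s) M ∶ τ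
  weak : ∀ {t k m} {Θ : Ctx t k} {Γ : Ctx t m} {M τ} {σ : Ty 0} {h : NoAllT neg σ} →
         (s : Split Θ (§ σ h ∷ []) Γ) →
         Γ ⊢ M ∶ τ → Θ ⊢ discard σ (var (embL s zero)) (renTm (embR s) M) ∶ τ
  cntr : ∀ {t k m} {Θ : Ctx t k} {Γ : Ctx t m} {M τ} {σ : Ty 0} {h : NoAllT neg σ} {V : Tm 0} →
         (s : Split Θ (§ σ h ∷ []) Γ) →
         (§ σ h ∷ § σ h ∷ Γ) ⊢ M ∶ τ → IsValue V → [] ⊢ V ∶ σ →
         Θ ⊢ copy σ V (var (embL s zero)) (renTm (ins2 s) M) ∶ τ

CutFree : ∀ {t k} {Γ : Ctx t k} {M τ} → Γ ⊢ M ∶ τ → Set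
CutFree ax                 = ⊤
CutFree (cut s D E)        = ⊥
CutFree (⊸R D)             = CutFree D
CutFree (⊸L s₁ s₂ D E)     = CutFree D × CutFree E
CutFree (∀R D)             = CutFree D
CutFree (∀L s D)           = CutFree D
CutFree (prom a D)         = CutFree D
CutFree (der s D)          = CutFree D
CutFree (weak s D)         = CutFree D
CutFree (cntr s D v E)     = CutFree D × CutFree E

LazyJ : ∀ {t k} → Ctx t k → Ty t → Set
LazyJ Γ τ = All (NoAllT pos) Γ × LazyTy τ

dsize : ∀ {t k} {Γ : Ctx t k} {M τ} → Γ ⊢ M ∶ τ → ℕ
dsize ax             = 1
dsize (cut s D E)    = dsize D + dsize E + 1
dsize (⊸R D)         = dsize D + 1
dsize (⊸L s₁ s₂ D E) = dsize D + dsize E + 1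
dsize (∀R D)         = dsize D + 1
dsize (∀L s D)       = dsize D + 1
dsize (prom a D)     = dsize D + 1
dsize (der s D)      = dsize D + 1
dsize (weak s D)     = dsize D + 1
dsize (cntr s D v E) = dsize D + dsize E + 3

lsize : ∀ {t} → LTy t → ℕ
tsize : ∀ {t} → Ty t → ℕ
lsize (tv i)  = 1
lsize (σ ⊸ A) = 1 + tsize σ + lsize A
lsize (Π A)   = 1 + lsize A
tsize (lin A)   = lsize A
tsize (§ σ h)   = 1 + tsize σ

lquant : ∀ {t} → LTy t → ℕ
tquant : ∀ {t} → Ty t → ℕ
lquant (tv i)  = 0
lquant (σ ⊸ A) = tquant σ + lquant A
lquant (Π A)   = 1 + lquant A
tquant (lin A) = lquant A
tquant (§ σ h) = 1 + tquant σ

tmsize : ∀ {k} → Tm k → ℕ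
tmsize (var i)         = 1
tmsize (lam M)         = 1 + tmsize M
tmsize (app M N)       = 1 + tmsize M + tmsize N
tmsize (discard σ M N) = 1 + tmsize M + tmsize N
tmsize (copy σ V M N)  = 1 + tmsize M + tmsize N

-- In a cut-free lazy derivation no rule can act on a ∀ or a § of the context: a context formula
-- has no positive ∀, while a §σ has no negative ∀ in σ, and no closed type is free of both.
-- Hence only the axiom, ⊸R, ⊸L, ∀R and promotion with empty context occur.  The first three
-- build a linear normal term node by node, ∀R and promotion add a derivation node for the
-- quantifier they introduce, which gives (1), (3) and then (4).  For (2) and (5), any derivation
-- of a pure normal term, cuts included, yields a bidirectional typing; on lazy types the latter
-- bounds |M| by the sizes of the used hypotheses plus |σ|.  A closed value thus has size at most
-- |σ|, and there are only finitely many pure closed terms of bounded size.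
module Submission where

open import Defs
open import Data.Nat using (ℕ; zero; suc; _+_; _*_; _≤_; z≤n; s≤s)
open import Data.Nat.Properties hiding (suc-injective)
open import Data.Nat.Tactic.RingSolver using (solve-∀)
open import Algebra.Properties.CommutativeMonoid.Sum +-0-commutativeMonoid
  using (sum-cong-≗; ∑-distrib-+; sum-replicate-zero) renaming (sum to ∑)
open import Data.Fin using (Fin; zero; suc)
open import Data.Fin.Properties using (suc-injective) renaming (_≟_ to _≟ᶠ_)
open import Data.Vec using ([]; _∷_; map; sum; lookup)
open import Data.Vec.Properties using (lookup-map)
open import Data.Vec.Relation.Unary.All using (All; []; _∷_)
open import Data.Vec.Relation.Unary.All.Properties using (lookup⁺)
import Data.List as List
open import Data.List using (List)
open import Data.List.Membership.Propositional using (_∈_)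
open import Data.List.Membership.Propositional.Properties
  using (∈-map⁺; ∈-++⁺ˡ; ∈-++⁺ʳ; ∈-allFin; ∈-cartesianProductWith⁺)
open import Data.Product using (_×_; _,_; proj₁; proj₂; ∃)
open import Data.Empty using (⊥; ⊥-elim)
open import Data.Unit using (tt)
open import Function using (_∘_)
open import Relation.Nullary using (¬_; yes; no)
open import Relation.Binary.PropositionalEquality
  using (_≡_; refl; sym; trans; cong; cong₂; subst; subst₂; module ≡-Reasoning)

∑-ones : ∀ n → ∑ {n} (λ _ → 1) ≡ n
∑-ones zero    = refl
∑-ones (suc n) = cong suc (∑-ones n)

∑-split : ∀ {t k l m} {Θ : Ctx t k} {Γ : Ctx t l} {Δ : Ctx t m} (s : Split Θ Γ Δ) (g : Fin k → ℕ) →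
          ∑ (g ∘ embL s) + ∑ (g ∘ embR s) ≡ ∑ g
∑-split []        g = refl
∑-split (left s)  g = trans (+-assoc (g zero) _ _) (cong (g zero +_) (∑-split s (g ∘ suc)))
∑-split (right s) g = begin
  ∑ (g ∘ suc ∘ embL s) + (g zero + ∑ (g ∘ suc ∘ embR s)) ≡⟨ swap (∑ (g ∘ suc ∘ embL s)) (g zero) _ ⟩
  g zero + (∑ (g ∘ suc ∘ embL s) + ∑ (g ∘ suc ∘ embR s)) ≡⟨ cong (g zero +_) (∑-split s (g ∘ suc)) ⟩
  g zero + ∑ (g ∘ suc)                                   ∎
  where
  open ≡-Reasoning
  swap : ∀ a b c → a + (b + c) ≡ b + (a + c)
  swap = solve-∀

sum-map≡∑-lookup : ∀ {t k} (g : Ty t → ℕ) (Γ : Ctx t k) → sum (map g Γ) ≡ ∑ (g ∘ lookup Γ)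
sum-map≡∑-lookup g []      = refl
sum-map≡∑-lookup g (σ ∷ Γ) = cong (g σ +_) (sum-map≡∑-lookup g Γ)

sum-map-split : ∀ {t k l m} {Θ : Ctx t k} {Γ : Ctx t l} {Δ : Ctx t m} (g : Ty t → ℕ) →
                Split Θ Γ Δ → sum (map g Θ) ≡ sum (map g Γ) + sum (map g Δ)
sum-map-split g []        = refl
sum-map-split {Θ = σ ∷ _} g (left s) = trans (cong (g σ +_) (sum-map-split g s)) (sym (+-assoc (g σ) _ _))
sum-map-split {Θ = σ ∷ _} {Γ = Γ} {Δ = _ ∷ Δ} g (right s) =
  trans (cong (g σ +_) (sum-map-split g s)) (swap (g σ) (sum (map g Γ)) (sum (map g Δ)))
  where
  swap : ∀ a b c → a + (b + c) ≡ b + (a + c)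
  swap = solve-∀

sum-map-renT : ∀ {t t′ k} (ρ : Fin t → Fin t′) (g : ∀ {t} → Ty t → ℕ) →
               (∀ {t t′} (ρ : Fin t → Fin t′) σ → g (renT ρ σ) ≡ g σ) →
               (Γ : Ctx t k) → sum (map g (map (renT ρ) Γ)) ≡ sum (map g Γ)
sum-map-renT ρ g g-renT []      = refl
sum-map-renT ρ g g-renT (σ ∷ Γ) = cong₂ _+_ (g-renT ρ σ) (sum-map-renT ρ g g-renT Γ)

extR-cong : ∀ {n m} {ρ ρ′ : Fin n → Fin m} → (∀ i → ρ i ≡ ρ′ i) → ∀ i → extR ρ i ≡ extR ρ′ i
extR-cong e zero    = refl
extR-cong e (suc i) = cong suc (e i)

renL-cong : ∀ {n m} {ρ ρ′ : Fin n → Fin m} → (∀ i → ρ i ≡ ρ′ i) → ∀ A → renL ρ A ≡ renL ρ′ A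
renT-cong : ∀ {n m} {ρ ρ′ : Fin n → Fin m} → (∀ i → ρ i ≡ ρ′ i) → ∀ σ → renT ρ σ ≡ renT ρ′ σ
renL-cong e (tv i)  = cong tv (e i)
renL-cong e (σ ⊸ A) = cong₂ _⊸_ (renT-cong e σ) (renL-cong e A)
renL-cong e (Π A)   = cong Π (renL-cong (extR-cong e) A)
renT-cong e (lin A) = cong lin (renL-cong e A)
renT-cong e (§ σ h) = refl

extS-cong : ∀ {n m} {s s′ : Fin n → LTy m} → (∀ i → s i ≡ s′ i) → ∀ i → extS s i ≡ extS s′ i
extS-cong e zero    = refl
extS-cong e (suc i) = cong (renL suc) (e i)

substL-cong : ∀ {n m} {s s′ : Fin n → LTy m} → (∀ i → s i ≡ s′ i) → ∀ A → substL s A ≡ substL s′ A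
substT-cong : ∀ {n m} {s s′ : Fin n → LTy m} → (∀ i → s i ≡ s′ i) → ∀ σ → substT s σ ≡ substT s′ σ
substL-cong e (tv i)  = e i
substL-cong e (σ ⊸ A) = cong₂ _⊸_ (substT-cong e σ) (substL-cong e A)
substL-cong e (Π A)   = cong Π (substL-cong (extS-cong e) A)
substT-cong e (lin A) = cong lin (substL-cong e A)
substT-cong e (§ σ h) = refl

renL-∘ : ∀ {n m l} (ρ : Fin m → Fin l) (ρ′ : Fin n → Fin m) A → renL ρ (renL ρ′ A) ≡ renL (ρ ∘ ρ′) A
renT-∘ : ∀ {n m l} (ρ : Fin m → Fin l) (ρ′ : Fin n → Fin m) σ → renT ρ (renT ρ′ σ) ≡ renT (ρ ∘ ρ′) σ
renL-∘ ρ ρ′ (tv i)  = refl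
renL-∘ ρ ρ′ (σ ⊸ A) = cong₂ _⊸_ (renT-∘ ρ ρ′ σ) (renL-∘ ρ ρ′ A)
renL-∘ ρ ρ′ (Π A)   =
  cong Π (trans (renL-∘ (extR ρ) (extR ρ′) A) (renL-cong (λ { zero → refl ; (suc i) → refl }) A))
renT-∘ ρ ρ′ (lin A) = cong lin (renL-∘ ρ ρ′ A)
renT-∘ ρ ρ′ (§ σ h) = refl

substL-renL : ∀ {n m l} (s : Fin m → LTy l) (ρ : Fin n → Fin m) A → substL s (renL ρ A) ≡ substL (s ∘ ρ) A
substT-renT : ∀ {n m l} (s : Fin m → LTy l) (ρ : Fin n → Fin m) σ → substT s (renT ρ σ) ≡ substT (s ∘ ρ) σ
substL-renL s ρ (tv i)  = refl
substL-renL s ρ (σ ⊸ A) = cong₂ _⊸_ (substT-renT s ρ σ) (substL-renL s ρ A)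
substL-renL s ρ (Π A)   =
  cong Π (trans (substL-renL (extS s) (extR ρ) A) (substL-cong (λ { zero → refl ; (suc i) → refl }) A))
substT-renT s ρ (lin A) = cong lin (substL-renL s ρ A)
substT-renT s ρ (§ σ h) = refl

renL-substL : ∀ {n m l} (ρ : Fin m → Fin l) (s : Fin n → LTy m) A → renL ρ (substL s A) ≡ substL (renL ρ ∘ s) A
renT-substT : ∀ {n m l} (ρ : Fin m → Fin l) (s : Fin n → LTy m) σ → renT ρ (substT s σ) ≡ substT (renL ρ ∘ s) σ
renL-substL ρ s (tv i)  = refl
renL-substL ρ s (σ ⊸ A) = cong₂ _⊸_ (renT-substT ρ s σ) (renL-substL ρ s A)
renL-substL ρ s (Π A)   = cong Π (trans (renL-substL (extR ρ) (extS s) A) (substL-cong ext-comm A))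
  where
  ext-comm : ∀ i → renL (extR ρ) (extS s i) ≡ extS (renL ρ ∘ s) i
  ext-comm zero    = refl
  ext-comm (suc i) = trans (renL-∘ (extR ρ) suc (s i)) (sym (renL-∘ suc ρ (s i)))
renT-substT ρ s (lin A) = cong lin (renL-substL ρ s A)
renT-substT ρ s (§ σ h) = refl

substL-substL : ∀ {n m l} (s : Fin m → LTy l) (s′ : Fin n → LTy m) A →
                substL s (substL s′ A) ≡ substL (substL s ∘ s′) A
substT-substT : ∀ {n m l} (s : Fin m → LTy l) (s′ : Fin n → LTy m) σ →
                substT s (substT s′ σ) ≡ substT (substL s ∘ s′) σ
substL-substL s s′ (tv i)  = refl
substL-substL s s′ (σ ⊸ A) = cong₂ _⊸_ (substT-substT s s′ σ) (substL-substL s s′ A)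
substL-substL s s′ (Π A)   = cong Π (trans (substL-substL (extS s) (extS s′) A) (substL-cong ext-comm A))
  where
  ext-comm : ∀ i → substL (extS s) (extS s′ i) ≡ extS (substL s ∘ s′) i
  ext-comm zero    = refl
  ext-comm (suc i) = trans (substL-renL (extS s) suc (s′ i)) (sym (renL-substL suc s (s′ i)))
substT-substT s s′ (lin A) = cong lin (substL-substL s s′ A)
substT-substT s s′ (§ σ h) = refl

substL-tv : ∀ {n} (A : LTy n) → substL tv A ≡ A
substT-tv : ∀ {n} (σ : Ty n) → substT tv σ ≡ σ
substL-tv (tv i)  = refl
substL-tv (σ ⊸ A) = cong₂ _⊸_ (substT-tv σ) (substL-tv A)
substL-tv (Π A)   = cong Π (trans (substL-cong (λ { zero → refl ; (suc i) → refl }) A) (substL-tv A))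
substT-tv (lin A) = cong lin (substL-tv A)
substT-tv (§ σ h) = refl

renL≡substL : ∀ {n m} (ρ : Fin n → Fin m) A → renL ρ A ≡ substL (tv ∘ ρ) A
renT≡substT : ∀ {n m} (ρ : Fin n → Fin m) σ → renT ρ σ ≡ substT (tv ∘ ρ) σ
renL≡substL ρ (tv i)  = refl
renL≡substL ρ (σ ⊸ A) = cong₂ _⊸_ (renT≡substT ρ σ) (renL≡substL ρ A)
renL≡substL ρ (Π A)   =
  cong Π (trans (renL≡substL (extR ρ) A) (substL-cong (λ { zero → refl ; (suc i) → refl }) A))
renT≡substT ρ (lin A) = cong lin (renL≡substL ρ A)
renT≡substT ρ (§ σ h) = refl

substT-emb : ∀ {n m} (s : Fin n → LTy m) (σ : Ty 0) → substT s (emb σ) ≡ emb σ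
substT-emb s σ = trans (substT-renT s (λ ()) σ) (trans (substT-cong (λ ()) σ) (sym (renT≡substT (λ ()) σ)))

substT-single-renT : ∀ {n} (B : LTy n) (σ : Ty n) → substT (single B) (renT suc σ) ≡ σ
substT-single-renT B σ = trans (substT-renT (single B) suc σ) (substT-tv σ)

substT-extS-renT : ∀ {n m} (s : Fin n → LTy m) (σ : Ty n) →
                   substT (extS s) (renT suc σ) ≡ renT suc (substT s σ)
substT-extS-renT s σ = trans (substT-renT (extS s) suc σ) (sym (renT-substT suc s σ))

substL-⟨⟩ : ∀ {n m} (s : Fin n → LTy m) (A : LTy (suc n)) (B : LTy n) →
            substL s (A ⟨ B ⟩) ≡ (substL (extS s) A) ⟨ substL s B ⟩
substL-⟨⟩ s A B =
  trans (substL-substL s (single B) A)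
        (trans (substL-cong pointwise A) (sym (substL-substL (single (substL s B)) (extS s) A)))
  where
  pointwise : ∀ i → substL s (single B i) ≡ substL (single (substL s B)) (extS s i)
  pointwise zero    = refl
  pointwise (suc i) = sym (trans (substL-renL (single (substL s B)) suc (s i)) (substL-tv (s i)))

lsize-renL : ∀ {n m} (ρ : Fin n → Fin m) A → lsize (renL ρ A) ≡ lsize A
tsize-renT : ∀ {n m} (ρ : Fin n → Fin m) σ → tsize (renT ρ σ) ≡ tsize σ
lsize-renL ρ (tv i)  = refl
lsize-renL ρ (σ ⊸ A) = cong₂ (λ a b → suc (a + b)) (tsize-renT ρ σ) (lsize-renL ρ A)
lsize-renL ρ (Π A)   = cong suc (lsize-renL (extR ρ) A)
tsize-renT ρ (lin A) = lsize-renL ρ A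
tsize-renT ρ (§ σ h) = refl

lquant-renL : ∀ {n m} (ρ : Fin n → Fin m) A → lquant (renL ρ A) ≡ lquant A
tquant-renT : ∀ {n m} (ρ : Fin n → Fin m) σ → tquant (renT ρ σ) ≡ tquant σ
lquant-renL ρ (tv i)  = refl
lquant-renL ρ (σ ⊸ A) = cong₂ _+_ (tquant-renT ρ σ) (lquant-renL ρ A)
lquant-renL ρ (Π A)   = cong suc (lquant-renL (extR ρ) A)
tquant-renT ρ (lin A) = lquant-renL ρ A
tquant-renT ρ (§ σ h) = refl

noAll-renL : ∀ {n m p} (ρ : Fin n → Fin m) {A} → NoAllL p A → NoAllL p (renL ρ A)
noAll-renT : ∀ {n m p} (ρ : Fin n → Fin m) {σ} → NoAllT p σ → NoAllT p (renT ρ σ)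
noAll-renL ρ tv      = tv
noAll-renL ρ (a ⊸ b) = noAll-renT ρ a ⊸ noAll-renL ρ b
noAll-renL ρ (Π a)   = Π (noAll-renL (extR ρ) a)
noAll-renT ρ (lin a) = lin (noAll-renL ρ a)
noAll-renT ρ (§ a)   = § a

noAll-renT-map : ∀ {t t′ k p} (ρ : Fin t → Fin t′) {Γ : Ctx t k} →
                 All (NoAllT p) Γ → All (NoAllT p) (map (renT ρ) Γ)
noAll-renT-map ρ []       = []
noAll-renT-map ρ (a ∷ as) = noAll-renT ρ a ∷ noAll-renT-map ρ as

-- A closed type has a ∀, since its innermost result type cannot be a variable.
¬closed-∀-free : {σ : Ty 0} → NoAllT pos σ → NoAllT neg σ → ⊥
¬closed-∀-free (lin a) (lin b) = ¬closedL a b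
  where
  ¬closedL : {A : LTy 0} → NoAllL pos A → NoAllL neg A → ⊥
  ¬closedL {tv ()} _ _
  ¬closedL (_ ⊸ a) (_ ⊸ b) = ¬closedL a b
¬closed-∀-free (§ a) (§ b) = ¬closed-∀-free a b

¬§-noAll-pos : ∀ {t} {σ : Ty 0} {h : NoAllT neg σ} → ¬ NoAllT {t} pos (§ σ h)
¬§-noAll-pos {h = h} (§ a) = ¬closed-∀-free a h

lquant-∀-free : ∀ {t p} {A : LTy t} → NoAllL p A → NoAllL (flip p) A → lquant A ≡ 0
tquant-∀-free : ∀ {t p} {σ : Ty t} → NoAllT p σ → NoAllT (flip p) σ → tquant σ ≡ 0
lquant-∀-free tv tv = refl
lquant-∀-free {p = pos} (a ⊸ b) (c ⊸ d) = cong₂ _+_ (tquant-∀-free a c) (lquant-∀-free b d)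
lquant-∀-free {p = neg} (a ⊸ b) (c ⊸ d) = cong₂ _+_ (tquant-∀-free a c) (lquant-∀-free b d)
lquant-∀-free (Π a) ()
tquant-∀-free (lin a) (lin b) = lquant-∀-free a b
tquant-∀-free {p = pos} (§ a) (§ b) = ⊥-elim (¬closed-∀-free a b)
tquant-∀-free {p = neg} (§ a) (§ b) = ⊥-elim (¬closed-∀-free b a)

occ-var-self : ∀ {k} (i : Fin k) → occ i (var i) ≡ 1
occ-var-self i with i ≟ᶠ i
... | yes _  = refl
... | no i≢i = ⊥-elim (i≢i refl)

occ-var-other : ∀ {k} {i j : Fin k} → ¬ i ≡ j → occ i (var j) ≡ 0
occ-var-other {i = i} {j} i≢j with i ≟ᶠ j
... | yes i≡j = ⊥-elim (i≢j i≡j)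
... | no _    = refl

occ-var-suc : ∀ {k} (i j : Fin k) → occ (suc i) (var (suc j)) ≡ occ i (var j)
occ-var-suc i j with i ≟ᶠ j
... | yes refl = refl
... | no _     = refl

∑-occ-var-* : ∀ {k} (i : Fin k) (g : Fin k → ℕ) → ∑ (λ j → occ j (var i) * g j) ≡ g i
∑-occ-var-* {suc k} zero    g =
  trans (cong₂ _+_ (*-identityˡ (g zero)) (sum-replicate-zero k)) (+-identityʳ (g zero))
∑-occ-var-* {suc k} (suc i) g =
  trans (sum-cong-≗ (λ j → cong (_* g (suc j)) (occ-var-suc j i))) (∑-occ-var-* i (g ∘ suc))

∑-occ-var : ∀ {k} (j : Fin k) → ∑ (λ i → occ j (var i)) ≡ 1
∑-occ-var {suc k} zero    = cong suc (sum-replicate-zero k)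
∑-occ-var {suc k} (suc j) = trans (sum-cong-≗ (occ-var-suc j)) (∑-occ-var j)

∑-occ-app : ∀ {k} (M N : Tm k) (g : Fin k → ℕ) →
            ∑ (λ i → (occ i M + occ i N) * g i) ≡ ∑ (λ i → occ i M * g i) + ∑ (λ i → occ i N * g i)
∑-occ-app M N g = trans (sum-cong-≗ (λ i → *-distribʳ-+ (g i) (occ i M) (occ i N)))
                        (∑-distrib-+ (λ i → occ i M * g i) (λ i → occ i N * g i))

extTm-cong : ∀ {n m} {f g : Fin n → Tm m} → (∀ i → f i ≡ g i) → ∀ i → extTm f i ≡ extTm g i
extTm-cong e zero    = refl
extTm-cong e (suc i) = cong (renTm suc) (e i)

substTm-cong : ∀ {n m} {f g : Fin n → Tm m} → (∀ i → f i ≡ g i) → ∀ M → substTm f M ≡ substTm g M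
substTm-cong e (var i)         = e i
substTm-cong e (lam M)         = cong lam (substTm-cong (extTm-cong e) M)
substTm-cong e (app M N)       = cong₂ app (substTm-cong e M) (substTm-cong e N)
substTm-cong e (discard σ M N) = cong₂ (discard σ) (substTm-cong e M) (substTm-cong e N)
substTm-cong e (copy σ V M N)  =
  cong₂ (copy σ V) (substTm-cong e M) (substTm-cong (extTm-cong (extTm-cong e)) N)

renTm≡substTm : ∀ {n m} (ρ : Fin n → Fin m) M → renTm ρ M ≡ substTm (var ∘ ρ) M
renTm≡substTm ρ (var i)         = refl
renTm≡substTm ρ (lam M)         =
  cong lam (trans (renTm≡substTm (extR ρ) M) (substTm-cong (λ { zero → refl ; (suc i) → refl }) M))
renTm≡substTm ρ (app M N)       = cong₂ app (renTm≡substTm ρ M) (renTm≡substTm ρ N)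
renTm≡substTm ρ (discard σ M N) = cong₂ (discard σ) (renTm≡substTm ρ M) (renTm≡substTm ρ N)
renTm≡substTm ρ (copy σ V M N)  = cong₂ (copy σ V) (renTm≡substTm ρ M)
  (trans (renTm≡substTm (extR (extR ρ)) N)
         (substTm-cong (λ { zero → refl ; (suc zero) → refl ; (suc (suc i)) → refl }) N))

tmsize-renTm : ∀ {n m} (ρ : Fin n → Fin m) M → tmsize (renTm ρ M) ≡ tmsize M
tmsize-renTm ρ (var i)         = refl
tmsize-renTm ρ (lam M)         = cong suc (tmsize-renTm (extR ρ) M)
tmsize-renTm ρ (app M N)       = cong₂ (λ a b → suc (a + b)) (tmsize-renTm ρ M) (tmsize-renTm ρ N)
tmsize-renTm ρ (discard σ M N) = cong₂ (λ a b → suc (a + b)) (tmsize-renTm ρ M) (tmsize-renTm ρ N)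
tmsize-renTm ρ (copy σ V M N)  =
  cong₂ (λ a b → suc (a + b)) (tmsize-renTm ρ M) (tmsize-renTm (extR (extR ρ)) N)

pure-renTm : ∀ {n m} (ρ : Fin n → Fin m) M → Pure M → Pure (renTm ρ M)
pure-renTm ρ (var i)   p       = tt
pure-renTm ρ (lam M)   p       = pure-renTm (extR ρ) M p
pure-renTm ρ (app M N) (p , q) = pure-renTm ρ M p , pure-renTm ρ N q

notLam-renTm : ∀ {n m} (ρ : Fin n → Fin m) M → NotLam M → NotLam (renTm ρ M)
notLam-renTm ρ (var i)         _ = tt
notLam-renTm ρ (app M N)       _ = tt
notLam-renTm ρ (discard σ M N) _ = tt
notLam-renTm ρ (copy σ V M N)  _ = tt

normal-renTm : ∀ {n m} (ρ : Fin n → Fin m) M → Normal M → Normal (renTm ρ M)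
normal-renTm ρ (var i)         _           = tt
normal-renTm ρ (lam M)         p           = normal-renTm (extR ρ) M p
normal-renTm ρ (app M N)       (a , b , c) = notLam-renTm ρ M a , normal-renTm ρ M b , normal-renTm ρ N c
normal-renTm ρ (discard σ M N) (b , c)     = normal-renTm ρ M b , normal-renTm ρ N c
normal-renTm ρ (copy σ V M N)  (b , c)     = normal-renTm ρ M b , normal-renTm (extR (extR ρ)) N c

occ-renTm : ∀ {n m} (ρ : Fin n → Fin m) (j : Fin n) → (∀ i → ρ i ≡ ρ j → i ≡ j) →
            ∀ M → occ (ρ j) (renTm ρ M) ≡ occ j M
occ-renTm ρ j inj (var i) with j ≟ᶠ i
... | yes refl = occ-var-self (ρ j)
... | no j≢i   = occ-var-other (λ e → j≢i (sym (inj i (sym e))))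
occ-renTm ρ j inj (lam M)         = occ-renTm (extR ρ) (suc j) inj′ M
  where
  inj′ : ∀ i → extR ρ i ≡ extR ρ (suc j) → i ≡ suc j
  inj′ (suc i) e = cong suc (inj i (suc-injective e))
occ-renTm ρ j inj (app M N)       = cong₂ _+_ (occ-renTm ρ j inj M) (occ-renTm ρ j inj N)
occ-renTm ρ j inj (discard σ M N) = cong₂ _+_ (occ-renTm ρ j inj M) (occ-renTm ρ j inj N)
occ-renTm ρ j inj (copy σ V M N)  =
  cong₂ _+_ (occ-renTm ρ j inj M) (occ-renTm (extR (extR ρ)) (suc (suc j)) inj′ N)
  where
  inj′ : ∀ i → extR (extR ρ) i ≡ extR (extR ρ) (suc (suc j)) → i ≡ suc (suc j)
  inj′ (suc (suc i)) e = cong (λ x → suc (suc x)) (inj i (suc-injective (suc-injective e)))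

occ-renTm-∉ : ∀ {n m} (ρ : Fin n → Fin m) (j : Fin m) → (∀ i → ¬ ρ i ≡ j) → ∀ M → occ j (renTm ρ M) ≡ 0
occ-renTm-∉ ρ j ∉ (var i)         = occ-var-other (λ e → ∉ i (sym e))
occ-renTm-∉ ρ j ∉ (lam M)         = occ-renTm-∉ (extR ρ) (suc j) ∉′ M
  where
  ∉′ : ∀ i → ¬ extR ρ i ≡ suc j
  ∉′ zero    ()
  ∉′ (suc i) e = ∉ i (suc-injective e)
occ-renTm-∉ ρ j ∉ (app M N)       = cong₂ _+_ (occ-renTm-∉ ρ j ∉ M) (occ-renTm-∉ ρ j ∉ N)
occ-renTm-∉ ρ j ∉ (discard σ M N) = cong₂ _+_ (occ-renTm-∉ ρ j ∉ M) (occ-renTm-∉ ρ j ∉ N)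
occ-renTm-∉ ρ j ∉ (copy σ V M N)  =
  cong₂ _+_ (occ-renTm-∉ ρ j ∉ M) (occ-renTm-∉ (extR (extR ρ)) (suc (suc j)) ∉′ N)
  where
  ∉′ : ∀ i → ¬ extR (extR ρ) i ≡ suc (suc j)
  ∉′ zero          ()
  ∉′ (suc zero)    ()
  ∉′ (suc (suc i)) e = ∉ i (suc-injective (suc-injective e))

occ-suc-renTm : ∀ {n} (j : Fin n) M → occ (suc j) (renTm suc M) ≡ occ j M
occ-suc-renTm j = occ-renTm suc j (λ i → suc-injective)

occ-zero-renTm : ∀ {n} (M : Tm n) → occ zero (renTm suc M) ≡ 0
occ-zero-renTm = occ-renTm-∉ suc zero (λ i ())

lamLinear-renTm : ∀ {n m} (ρ : Fin n → Fin m) M → LamLinear M → LamLinear (renTm ρ M)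
lamLinear-renTm ρ (var i)         _          = tt
lamLinear-renTm ρ (lam M)         (once , p) =
  trans (occ-renTm (extR ρ) zero (λ { zero _ → refl }) M) once , lamLinear-renTm (extR ρ) M p
lamLinear-renTm ρ (app M N)       (p , q)    = lamLinear-renTm ρ M p , lamLinear-renTm ρ N q
lamLinear-renTm ρ (discard σ M N) (p , q)    = lamLinear-renTm ρ M p , lamLinear-renTm ρ N q
lamLinear-renTm ρ (copy σ V M N)  (p , q)    = lamLinear-renTm ρ M p , lamLinear-renTm (extR (extR ρ)) N q

occ-substTm : ∀ {n m} (f : Fin n → Tm m) M → Pure M →
              ∀ j → occ j (substTm f M) ≡ ∑ (λ i → occ i M * occ j (f i))
occ-substTm f (var i)   _       j = sym (∑-occ-var-* i (λ i′ → occ j (f i′)))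
occ-substTm f (lam M)   p       j =
  trans (occ-substTm (extTm f) M p (suc j))
        (cong₂ _+_ (*-zeroʳ (occ zero M)) (sum-cong-≗ (λ i → cong (occ (suc i) M *_) (occ-suc-renTm j (f i)))))
occ-substTm f (app M N) (p , q) j =
  trans (cong₂ _+_ (occ-substTm f M p j) (occ-substTm f N q j)) (sym (∑-occ-app M N (λ i → occ j (f i))))

-- Both sides carry ∑ occ to avoid truncated subtraction: each occurrence of i grows from size 1 to tmsize (f i).
tmsize-substTm : ∀ {n m} (f : Fin n → Tm m) M → Pure M →
                 tmsize (substTm f M) + ∑ (λ i → occ i M) ≡ tmsize M + ∑ (λ i → occ i M * tmsize (f i))
tmsize-substTm f (var i)   _       = begin
  tmsize (f i) + ∑ (λ j → occ j (var i))       ≡⟨ cong (tmsize (f i) +_) ones ⟩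
  tmsize (f i) + 1                             ≡⟨ +-comm (tmsize (f i)) 1 ⟩
  1 + tmsize (f i)                             ≡⟨ cong suc (∑-occ-var-* i (tmsize ∘ f)) ⟨
  1 + ∑ (λ j → occ j (var i) * tmsize (f j))   ∎
  where
  open ≡-Reasoning
  ones : ∑ (λ j → occ j (var i)) ≡ 1
  ones = trans (sum-cong-≗ (λ j → sym (*-identityʳ (occ j (var i))))) (∑-occ-var-* i (λ _ → 1))
tmsize-substTm f (lam M)   p       = cong suc (+-cancelˡ-≡ (occ zero M) _ _ (begin
  occ zero M + (tmsize (substTm (extTm f) M) + ∑ (λ i → occ (suc i) M))
    ≡⟨ swap (occ zero M) (tmsize (substTm (extTm f) M)) _ ⟩
  tmsize (substTm (extTm f) M) + (occ zero M + ∑ (λ i → occ (suc i) M))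
    ≡⟨ tmsize-substTm (extTm f) M p ⟩
  tmsize M + (occ zero M * 1 + ∑ (λ i → occ (suc i) M * tmsize (renTm suc (f i))))
    ≡⟨ cong₂ (λ a b → tmsize M + (a + b)) (*-identityʳ (occ zero M))
             (sum-cong-≗ (λ i → cong (occ (suc i) M *_) (tmsize-renTm suc (f i)))) ⟩
  tmsize M + (occ zero M + ∑ (λ i → occ (suc i) M * tmsize (f i)))
    ≡⟨ swap (tmsize M) (occ zero M) _ ⟩
  occ zero M + (tmsize M + ∑ (λ i → occ (suc i) M * tmsize (f i))) ∎))
  where
  open ≡-Reasoning
  swap : ∀ a b c → a + (b + c) ≡ b + (a + c)
  swap = solve-∀
tmsize-substTm f (app M N) (p , q) = begin
  suc (m′ + n′) + ∑ (λ i → occ i M + occ i N) ≡⟨ cong (suc (m′ + n′) +_) (∑-distrib-+ (λ i → occ i M) _) ⟩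
  suc (m′ + n′) + (uM + uN)                   ≡⟨ interchange m′ n′ uM uN ⟩
  suc ((m′ + uM) + (n′ + uN))                 ≡⟨ cong₂ (λ a b → suc (a + b)) (tmsize-substTm f M p)
                                                                             (tmsize-substTm f N q) ⟩
  suc ((tmsize M + cM) + (tmsize N + cN))     ≡⟨ interchange (tmsize M) (tmsize N) cM cN ⟨
  suc (tmsize M + tmsize N) + (cM + cN)       ≡⟨ cong (suc (tmsize M + tmsize N) +_)
                                                     (∑-occ-app M N (tmsize ∘ f)) ⟨
  suc (tmsize M + tmsize N) + ∑ (λ i → (occ i M + occ i N) * tmsize (f i)) ∎
  where
  open ≡-Reasoning
  m′ = tmsize (substTm f M)
  n′ = tmsize (substTm f N)
  uM = ∑ (λ i → occ i M)
  uN = ∑ (λ i → occ i N)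
  cM = ∑ (λ i → occ i M * tmsize (f i))
  cN = ∑ (λ i → occ i N * tmsize (f i))
  interchange : ∀ a b c d → suc (a + b) + (c + d) ≡ suc ((a + c) + (b + d))
  interchange = solve-∀

occ-substTm-linear : ∀ {n m} (f : Fin n → Tm m) M → Pure M → (∀ i → occ i M ≡ 1) →
                     ∀ j → occ j (substTm f M) ≡ ∑ (λ i → occ j (f i))
occ-substTm-linear f M p once j =
  trans (occ-substTm f M p j) (sum-cong-≗ (λ i → trans (cong (_* occ j (f i)) (once i)) (*-identityˡ _)))

tmsize-substTm-linear : ∀ {n m} (f : Fin n → Tm m) M → Pure M → (∀ i → occ i M ≡ 1) →
                        tmsize (substTm f M) + n ≡ tmsize M + ∑ (tmsize ∘ f)
tmsize-substTm-linear {n} f M p once = begin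
  tmsize (substTm f M) + n                        ≡⟨ cong (tmsize (substTm f M) +_) (∑-ones n) ⟨
  tmsize (substTm f M) + ∑ {n} (λ _ → 1)          ≡⟨ cong (tmsize (substTm f M) +_) (sum-cong-≗ once) ⟨
  tmsize (substTm f M) + ∑ (λ i → occ i M)        ≡⟨ tmsize-substTm f M p ⟩
  tmsize M + ∑ (λ i → occ i M * tmsize (f i))     ≡⟨ cong (tmsize M +_) (sum-cong-≗ uses-once) ⟩
  tmsize M + ∑ (tmsize ∘ f)                       ∎
  where
  open ≡-Reasoning
  uses-once : ∀ i → occ i M * tmsize (f i) ≡ tmsize (f i)
  uses-once i = trans (cong (_* tmsize (f i)) (once i)) (*-identityˡ _)

pure-substTm : ∀ {n m} (f : Fin n → Tm m) M → Pure M → (∀ i → Pure (f i)) → Pure (substTm f M)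
pure-substTm f (var i)   _       pf = pf i
pure-substTm f (lam M)   p       pf =
  pure-substTm (extTm f) M p (λ { zero → tt ; (suc i) → pure-renTm suc (f i) (pf i) })
pure-substTm f (app M N) (p , q) pf = pure-substTm f M p pf , pure-substTm f N q pf

notLam-substTm : ∀ {n m} (f : Fin n → Tm m) M → NotLam M → (∀ i → NotLam (f i)) → NotLam (substTm f M)
notLam-substTm f (var i)         _ nf = nf i
notLam-substTm f (app M N)       _ nf = tt
notLam-substTm f (discard σ M N) _ nf = tt
notLam-substTm f (copy σ V M N)  _ nf = tt

normal-substTm : ∀ {n m} (f : Fin n → Tm m) M → Pure M → Normal M →
                 (∀ i → Normal (f i) × NotLam (f i)) → Normal (substTm f M)
normal-substTm f (var i)   _       _           nf = proj₁ (nf i)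
normal-substTm f (lam M)   p       nM          nf = normal-substTm (extTm f) M p nM nf′
  where
  nf′ : ∀ i → Normal (extTm f i) × NotLam (extTm f i)
  nf′ zero    = tt , tt
  nf′ (suc i) = normal-renTm suc (f i) (proj₁ (nf i)) , notLam-renTm suc (f i) (proj₂ (nf i))
normal-substTm f (app M N) (p , q) (a , b , c) nf =
  notLam-substTm f M a (proj₂ ∘ nf) , normal-substTm f M p b nf , normal-substTm f N q c nf

lamLinear-substTm : ∀ {n m} (f : Fin n → Tm m) M → Pure M → LamLinear M →
                    (∀ i → LamLinear (f i)) → LamLinear (substTm f M)
lamLinear-substTm f (var i)   _       _          lf = lf i
lamLinear-substTm {n} f (lam M) p   (once , l) lf = once′ , lamLinear-substTm (extTm f) M p l lf′
  where
  lf′ : ∀ i → LamLinear (extTm f i)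
  lf′ zero    = tt
  lf′ (suc i) = lamLinear-renTm suc (f i) (lf i)
  fresh : ∀ i → occ (suc i) M * occ zero (renTm suc (f i)) ≡ 0
  fresh i = trans (cong (occ (suc i) M *_) (occ-zero-renTm (f i))) (*-zeroʳ (occ (suc i) M))
  once′ : occ zero (substTm (extTm f) M) ≡ 1
  once′ = trans (occ-substTm (extTm f) M p zero)
                (cong₂ _+_ (trans (*-identityʳ (occ zero M)) once)
                           (trans (sum-cong-≗ fresh) (sum-replicate-zero n)))
lamLinear-substTm f (app M N) (p , q) (l , l′)   lf = lamLinear-substTm f M p l lf , lamLinear-substTm f N q l′ lf

pure-substTm⁻ : ∀ {n m} (f : Fin n → Tm m) M → Pure (substTm f M) → Pure M
pure-substTm⁻ f (var i)   _       = tt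
pure-substTm⁻ f (lam M)   p       = pure-substTm⁻ (extTm f) M p
pure-substTm⁻ f (app M N) (p , q) = pure-substTm⁻ f M p , pure-substTm⁻ f N q

notLam-substTm⁻ : ∀ {n m} (f : Fin n → Tm m) M → NotLam (substTm f M) → NotLam M
notLam-substTm⁻ f (var i)         _ = tt
notLam-substTm⁻ f (app M N)       _ = tt
notLam-substTm⁻ f (discard σ M N) _ = tt
notLam-substTm⁻ f (copy σ V M N)  _ = tt

normal-substTm⁻ : ∀ {n m} (f : Fin n → Tm m) M → Pure M → Normal (substTm f M) → Normal M
normal-substTm⁻ f (var i)   _       _           = tt
normal-substTm⁻ f (lam M)   p       nM          = normal-substTm⁻ (extTm f) M p nM
normal-substTm⁻ f (app M N) (p , q) (a , b , c) =
  notLam-substTm⁻ f M a , normal-substTm⁻ f M p b , normal-substTm⁻ f N q c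

pure-renTm⁻ : ∀ {n m} (ρ : Fin n → Fin m) M → Pure (renTm ρ M) → Pure M
pure-renTm⁻ ρ M p = pure-substTm⁻ (var ∘ ρ) M (subst Pure (renTm≡substTm ρ M) p)

normal-renTm⁻ : ∀ {n m} (ρ : Fin n → Fin m) M → Pure M → Normal (renTm ρ M) → Normal M
normal-renTm⁻ ρ M p nM = normal-substTm⁻ (var ∘ ρ) M p (subst Normal (renTm≡substTm ρ M) nM)

pure-normal-substTm⁻ : ∀ {n m} (f : Fin n → Tm m) M (i : Fin n) → Pure M → 1 ≤ occ i M →
                       Pure (substTm f M) → Normal (substTm f M) → Pure (f i) × Normal (f i)
pure-normal-substTm⁻ f (var j) i _ o p nM with i ≟ᶠ j
... | yes refl = p , nM
pure-normal-substTm⁻ f (var j) i _ () p nM | no _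
pure-normal-substTm⁻ f (lam M) i pM o p nM with pure-normal-substTm⁻ (extTm f) M (suc i) pM o p nM
... | p′ , n′ = pure-renTm⁻ suc (f i) p′ , normal-renTm⁻ suc (f i) (pure-renTm⁻ suc (f i) p′) n′
pure-normal-substTm⁻ f (app M N) i (pM , pN) o (p , p′) (_ , nM , nN) with occ i M in eq
... | zero  = pure-normal-substTm⁻ f N i pN o p′ nN
... | suc _ = pure-normal-substTm⁻ f M i pM (subst (1 ≤_) (sym eq) (s≤s z≤n)) p nM

all-split : ∀ {t k l m} {Θ : Ctx t k} {Γ : Ctx t l} {Δ : Ctx t m} {P : Ty t → Set} →
            Split Θ Γ Δ → All P Θ → All P Γ × All P Δ
all-split []        []       = [] , []
all-split (left s)  (p ∷ ps) = let (a , b) = all-split s ps in p ∷ a , b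
all-split (right s) (p ∷ ps) = let (a , b) = all-split s ps in a , p ∷ b

all-split-one : ∀ {t k m} {Θ : Ctx t k} {τ : Ty t} {Γ : Ctx t m} {P : Ty t → Set} →
                Split Θ (τ ∷ []) Γ → All P Θ → P τ × All P Γ
all-split-one s ps with all-split s ps
... | p ∷ [] , ps′ = p , ps′

record LinearNormal {k} (M : Tm k) : Set where
  field
    pure      : Pure M
    normal    : Normal M
    occ≡1     : ∀ i → occ i M ≡ 1
    lamLinear : LamLinear M

open LinearNormal

module _ {t k k′ l m} {Θ : Ctx t k} {τ : Ty t} {Θ′ : Ctx t k′} {Γ : Ctx t l} {Δ : Ctx t m}
         (s₁ : Split Θ (τ ∷ []) Θ′) (s₂ : Split Θ′ Γ Δ) {N : Tm l} (lnN : LinearNormal N) where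

  private
    ρN : Fin l → Fin k
    ρN i = embR s₁ (embL s₂ i)

    f : Fin (suc m) → Tm k
    f = arrSub s₁ s₂ N

  -- Each hypothesis of Θ is y, one of Γ (used once in N) or one of Δ, and is used exactly once.
  ∑-occ-arrSub : ∀ j → ∑ (λ i → occ j (f i)) ≡ 1
  ∑-occ-arrSub j = begin
    occ j (var (embL s₁ zero)) + occ j (renTm ρN N) + ∑ (g ∘ embR s₂)
      ≡⟨ cong (λ x → occ j (var (embL s₁ zero)) + x + ∑ (g ∘ embR s₂)) occ-N ⟩
    occ j (var (embL s₁ zero)) + ∑ (g ∘ embL s₂) + ∑ (g ∘ embR s₂)
      ≡⟨ +-assoc (occ j (var (embL s₁ zero))) _ _ ⟩
    occ j (var (embL s₁ zero)) + (∑ (g ∘ embL s₂) + ∑ (g ∘ embR s₂))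
      ≡⟨ cong₂ _+_ (sym (+-identityʳ _)) (∑-split s₂ g) ⟩
    (occ j (var (embL s₁ zero)) + 0) + ∑ g
      ≡⟨ ∑-split s₁ (λ i → occ j (var i)) ⟩
    ∑ (λ i → occ j (var i))
      ≡⟨ ∑-occ-var j ⟩
    1 ∎
    where
    open ≡-Reasoning
    g : Fin k′ → ℕ
    g i = occ j (var (embR s₁ i))
    occ-N : occ j (renTm ρN N) ≡ ∑ (g ∘ embL s₂)
    occ-N = trans (cong (occ j) (renTm≡substTm ρN N))
                  (occ-substTm-linear (var ∘ ρN) N (pure lnN) (occ≡1 lnN) j)

  linearNormal-arrSub : ∀ {M : Tm (suc m)} → LinearNormal M → LinearNormal (substTm f M)
  linearNormal-arrSub {M} lnM = record
    { pure      = pure-substTm f M (pure lnM) pure-f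
    ; normal    = normal-substTm f M (pure lnM) (normal lnM) normal-f
    ; occ≡1     = λ j → trans (occ-substTm-linear f M (pure lnM) (occ≡1 lnM) j) (∑-occ-arrSub j)
    ; lamLinear = lamLinear-substTm f M (pure lnM) (lamLinear lnM) lamLinear-f
    }
    where
    pure-f : ∀ i → Pure (f i)
    pure-f zero    = tt , pure-renTm ρN N (pure lnN)
    pure-f (suc i) = tt
    normal-f : ∀ i → Normal (f i) × NotLam (f i)
    normal-f zero    = (tt , tt , normal-renTm ρN N (normal lnN)) , tt
    normal-f (suc i) = tt , tt
    lamLinear-f : ∀ i → LamLinear (f i)
    lamLinear-f zero    = tt , lamLinear-renTm ρN N (lamLinear lnN)
    lamLinear-f (suc i) = tt

  tmsize-arrSub : ∀ {M : Tm (suc m)} → LinearNormal M → tmsize (substTm f M) ≡ tmsize N + tmsize M + 1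
  tmsize-arrSub {M} lnM = +-cancelʳ-≡ (suc m) _ _ (begin
    tmsize (substTm f M) + suc m              ≡⟨ tmsize-substTm-linear f M (pure lnM) (occ≡1 lnM) ⟩
    tmsize M + (2 + tmsize (renTm ρN N) + ∑ {m} (λ _ → 1))
      ≡⟨ cong₂ (λ a b → tmsize M + (2 + a + b)) (tmsize-renTm ρN N) (∑-ones m) ⟩
    tmsize M + (2 + tmsize N + m)             ≡⟨ rearrange (tmsize M) (tmsize N) m ⟩
    tmsize N + tmsize M + 1 + suc m           ∎)
    where
    open ≡-Reasoning
    rearrange : ∀ a b c → a + (2 + b + c) ≡ b + a + 1 + suc c
    rearrange = solve-∀

quant : ∀ {t k} → Ctx t k → Ty t → ℕ
quant Γ σ = sum (map tquant Γ) + tquant σ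

cutFree-lazy : ∀ {t k} {Γ : Ctx t k} {M : Tm k} {σ : Ty t} (D : Γ ⊢ M ∶ σ) → CutFree D →
               All (NoAllT pos) Γ → NoAllT neg σ → LinearNormal M × dsize D ≡ tmsize M + quant Γ σ
cutFree-lazy (ax {A = A}) _ (lin a ∷ []) (lin b) =
  record { pure = tt ; normal = tt ; occ≡1 = λ { zero → refl } ; lamLinear = tt } ,
  cong (λ q → 1 + ((q + 0) + q)) (sym (lquant-∀-free a b))
cutFree-lazy (cut _ _ _) () _ _
cutFree-lazy {Γ = Γ} (⊸R {σ = σ} {M = M} {B = B} D) cf lz (lin (a ⊸ b)) with cutFree-lazy D cf (a ∷ lz) (lin b)
... | lnM , dz =
  record { pure = pure lnM ; normal = normal lnM ; occ≡1 = occ≡1 lnM ∘ suc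
         ; lamLinear = occ≡1 lnM zero , lamLinear lnM } ,
  trans (cong (_+ 1) dz) (rearrange (tmsize M) (tquant σ) (sum (map tquant Γ)) (lquant B))
  where
  rearrange : ∀ m a g b → m + ((a + g) + b) + 1 ≡ suc m + (g + (a + b))
  rearrange = solve-∀
cutFree-lazy {Γ = Θ} (⊸L {Γ = Γ} {Δ = Δ} {N = N} {M = M} {σ = σ} {B = B} {τ = τ} s₁ s₂ D E)
             (cfD , cfE) lz lτ
  with all-split-one s₁ lz
... | lin (aσ ⊸ aB) , lz′ with all-split s₂ lz′
... | lzΓ , lzΔ with cutFree-lazy D cfD lzΓ aσ | cutFree-lazy E cfE (lin aB ∷ lzΔ) lτ
... | lnN , dzN | lnM , dzM = linearNormal-arrSub s₁ s₂ lnN lnM , (begin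
  dsize D + dsize E + 1
    ≡⟨ cong₂ (λ x y → x + y + 1) dzN dzM ⟩
  tmsize N + (qΓ + tquant σ) + (tmsize M + ((lquant B + qΔ) + tquant τ)) + 1
    ≡⟨ rearrange (tmsize N) (tmsize M) qΓ (tquant σ) (lquant B) qΔ (tquant τ) ⟩
  (tmsize N + tmsize M + 1) + ((((tquant σ + lquant B) + 0) + (qΓ + qΔ)) + tquant τ)
    ≡⟨ cong₂ (λ x y → x + (y + tquant τ)) (sym (tmsize-arrSub s₁ s₂ lnN lnM))
             (sym (trans (sum-map-split tquant s₁) (cong (_ +_) (sum-map-split tquant s₂)))) ⟩
  tmsize (substTm (arrSub s₁ s₂ N) M) + quant Θ τ ∎)
  where
  open ≡-Reasoning
  qΓ = sum (map tquant Γ)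
  qΔ = sum (map tquant Δ)
  rearrange : ∀ n m g a b d c → n + (g + a) + (m + ((b + d) + c)) + 1
                              ≡ (n + m + 1) + ((((a + b) + 0) + (g + d)) + c)
  rearrange = solve-∀
cutFree-lazy {Γ = Γ} (∀R {M = M} {A = A} D) cf lz (lin (Π a)) with cutFree-lazy D cf (noAll-renT-map suc lz) (lin a)
... | lnM , dz = lnM , (begin
  dsize D + 1                                        ≡⟨ cong (_+ 1) dz ⟩
  tmsize M + (sum (map tquant (map (renT suc) Γ)) + lquant A) + 1
    ≡⟨ cong (λ q → tmsize M + (q + lquant A) + 1) (sum-map-renT suc tquant tquant-renT Γ) ⟩
  tmsize M + (sum (map tquant Γ) + lquant A) + 1     ≡⟨ rearrange (tmsize M) (sum (map tquant Γ)) (lquant A) ⟩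
  tmsize M + (sum (map tquant Γ) + suc (lquant A))   ∎)
  where
  open ≡-Reasoning
  rearrange : ∀ m g a → m + (g + a) + 1 ≡ m + (g + suc a)
  rearrange = solve-∀
cutFree-lazy (∀L s _) _ lz _ with all-split-one s lz
... | lin () , _
cutFree-lazy {Γ = []} (prom {M = M} {σ = σ} _ D) cf [] (§ h) with cutFree-lazy D cf [] (noAll-renT (λ ()) h)
... | lnM , dz = lnM , (begin
  dsize D + 1                      ≡⟨ cong (_+ 1) dz ⟩
  tmsize M + tquant (emb σ) + 1    ≡⟨ cong (λ q → tmsize M + q + 1) (tquant-renT (λ ()) σ) ⟩
  tmsize M + tquant σ + 1          ≡⟨ +-assoc (tmsize M) (tquant σ) 1 ⟩
  tmsize M + (tquant σ + 1)        ≡⟨ cong (tmsize M +_) (+-comm (tquant σ) 1) ⟩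
  tmsize M + suc (tquant σ)        ∎)
  where open ≡-Reasoning
cutFree-lazy {Γ = _ ∷ _} (prom (box ∷ _) _) _ (p ∷ _) _ = ⊥-elim (¬§-noAll-pos p)
cutFree-lazy (der s _) _ lz _ = ⊥-elim (¬§-noAll-pos (proj₁ (all-split-one s lz)))
cutFree-lazy (weak s _) _ lz _ = ⊥-elim (¬§-noAll-pos (proj₁ (all-split-one s lz)))
cutFree-lazy (cntr s _ _ _) _ lz _ = ⊥-elim (¬§-noAll-pos (proj₁ (all-split-one s lz)))

infix 3 _⊢_⇐_ _⊢_⇒_

data _⊢_⇐_ : ∀ {t k} → Ctx t k → Tm k → Ty t → Set
data _⊢_⇒_ : ∀ {t k} → Ctx t k → Tm k → Ty t → Set

data _⊢_⇐_ where
  tNeu : ∀ {t k} {Γ : Ctx t k} {M τ} → Γ ⊢ M ⇒ τ → Γ ⊢ M ⇐ τ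
  tLam : ∀ {t k} {Γ : Ctx t k} {σ M B} → (σ ∷ Γ) ⊢ M ⇐ lin B → Γ ⊢ lam M ⇐ lin (σ ⊸ B)
  tGen : ∀ {t k} {Γ : Ctx t k} {M} {A : LTy (suc t)} → map (renT suc) Γ ⊢ M ⇐ lin A → Γ ⊢ M ⇐ lin (Π A)
  tBox : ∀ {t k} {Γ : Ctx t k} {M} {σ : Ty 0} {h : NoAllT neg σ} → Γ ⊢ M ⇐ emb σ → Γ ⊢ M ⇐ § σ h

data _⊢_⇒_ where
  tVar  : ∀ {t k} {Γ : Ctx t k} {i} → Γ ⊢ var i ⇒ lookup Γ i
  tApp  : ∀ {t k} {Γ : Ctx t k} {M P σ B} → Γ ⊢ M ⇒ lin (σ ⊸ B) → Γ ⊢ P ⇐ σ → Γ ⊢ app M P ⇒ lin B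
  tInst : ∀ {t k} {Γ : Ctx t k} {M} {A : LTy (suc t)} {B : LTy t} →
          Γ ⊢ M ⇒ lin (Π A) → Γ ⊢ M ⇒ lin (A ⟨ B ⟩)
  tDer  : ∀ {t k} {Γ : Ctx t k} {M} {σ : Ty 0} {h : NoAllT neg σ} → Γ ⊢ M ⇒ § σ h → Γ ⊢ M ⇒ emb σ

tVar′ : ∀ {t k} {Γ : Ctx t k} {i τ} → lookup Γ i ≡ τ → Γ ⊢ var i ⇒ τ
tVar′ refl = tVar

⇐-renTm : ∀ {t k k′} {Γ : Ctx t k} {Δ : Ctx t k′} (ρ : Fin k → Fin k′) →
          (∀ i → lookup Δ (ρ i) ≡ lookup Γ i) → ∀ {M τ} → Γ ⊢ M ⇐ τ → Δ ⊢ renTm ρ M ⇐ τ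
⇒-renTm : ∀ {t k k′} {Γ : Ctx t k} {Δ : Ctx t k′} (ρ : Fin k → Fin k′) →
          (∀ i → lookup Δ (ρ i) ≡ lookup Γ i) → ∀ {M τ} → Γ ⊢ M ⇒ τ → Δ ⊢ renTm ρ M ⇒ τ
⇐-renTm ρ e (tNeu S) = tNeu (⇒-renTm ρ e S)
⇐-renTm ρ e (tLam D) = tLam (⇐-renTm (extR ρ) (λ { zero → refl ; (suc i) → e i }) D)
⇐-renTm {Γ = Γ} {Δ} ρ e (tGen D) = tGen (⇐-renTm ρ e′ D)
  where
  e′ : ∀ i → lookup (map (renT suc) Δ) (ρ i) ≡ lookup (map (renT suc) Γ) i
  e′ i = trans (lookup-map (ρ i) (renT suc) Δ) (trans (cong (renT suc) (e i)) (sym (lookup-map i (renT suc) Γ)))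
⇐-renTm ρ e (tBox D) = tBox (⇐-renTm ρ e D)
⇒-renTm ρ e (tVar {i = i}) = tVar′ (e i)
⇒-renTm ρ e (tApp S P)     = tApp (⇒-renTm ρ e S) (⇐-renTm ρ e P)
⇒-renTm ρ e (tInst S)      = tInst (⇒-renTm ρ e S)
⇒-renTm ρ e (tDer S)       = tDer (⇒-renTm ρ e S)

map-substT-extS-renT : ∀ {n m k} (s : Fin n → LTy m) (Γ : Ctx n k) →
                       map (substT (extS s)) (map (renT suc) Γ) ≡ map (renT suc) (map (substT s) Γ)
map-substT-extS-renT s []      = refl
map-substT-extS-renT s (σ ∷ Γ) = cong₂ _∷_ (substT-extS-renT s σ) (map-substT-extS-renT s Γ)

⇐-substT : ∀ {n m k} (s : Fin n → LTy m) {Γ : Ctx n k} {M τ} → Γ ⊢ M ⇐ τ → map (substT s) Γ ⊢ M ⇐ substT s τ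
⇒-substT : ∀ {n m k} (s : Fin n → LTy m) {Γ : Ctx n k} {M τ} → Γ ⊢ M ⇒ τ → map (substT s) Γ ⊢ M ⇒ substT s τ
⇐-substT s (tNeu S) = tNeu (⇒-substT s S)
⇐-substT s (tLam D) = tLam (⇐-substT s D)
⇐-substT s {Γ} {M} (tGen D) =
  tGen (subst (λ Γ′ → Γ′ ⊢ M ⇐ _) (map-substT-extS-renT s Γ) (⇐-substT (extS s) D))
⇐-substT s {Γ} {M} (tBox {σ = σ} D) =
  tBox (subst (λ τ → map (substT s) Γ ⊢ M ⇐ τ) (substT-emb s σ) (⇐-substT s D))
⇒-substT s {Γ} (tVar {i = i}) = tVar′ (lookup-map i (substT s) Γ)
⇒-substT s (tApp S P) = tApp (⇒-substT s S) (⇐-substT s P)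
⇒-substT s {Γ} {M} (tInst {A = A} {B = B} S) =
  subst (λ τ → map (substT s) Γ ⊢ M ⇒ lin τ) (sym (substL-⟨⟩ s A B)) (tInst (⇒-substT s S))
⇒-substT s {Γ} {M} (tDer {σ = σ} S) =
  subst (λ τ → map (substT s) Γ ⊢ M ⇒ τ) (sym (substT-emb s σ)) (tDer (⇒-substT s S))

map-substT-tv∘ : ∀ {n m k} (ρ : Fin n → Fin m) (Γ : Ctx n k) → map (substT (tv ∘ ρ)) Γ ≡ map (renT ρ) Γ
map-substT-tv∘ ρ []      = refl
map-substT-tv∘ ρ (σ ∷ Γ) = cong₂ _∷_ (sym (renT≡substT ρ σ)) (map-substT-tv∘ ρ Γ)

⇐-renT : ∀ {n m k} (ρ : Fin n → Fin m) {Γ : Ctx n k} {M τ} → Γ ⊢ M ⇐ τ → map (renT ρ) Γ ⊢ M ⇐ renT ρ τ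
⇐-renT ρ {Γ} {M} {τ} D =
  subst₂ (λ Γ′ τ′ → Γ′ ⊢ M ⇐ τ′) (map-substT-tv∘ ρ Γ) (sym (renT≡substT ρ τ)) (⇐-substT (tv ∘ ρ) D)

map-substT-single-renT : ∀ {n k} (B : LTy n) (Γ : Ctx n k) → map (substT (single B)) (map (renT suc) Γ) ≡ Γ
map-substT-single-renT B []      = refl
map-substT-single-renT B (σ ∷ Γ) = cong₂ _∷_ (substT-single-renT B σ) (map-substT-single-renT B Γ)

⇐-inst : ∀ {t k} {Γ : Ctx t k} {N} {A : LTy (suc t)} (B : LTy t) → Γ ⊢ N ⇐ lin (Π A) → Γ ⊢ N ⇐ lin (A ⟨ B ⟩)
⇐-inst B (tNeu S) = tNeu (tInst S)
⇐-inst {Γ = Γ} {N} B (tGen D) =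
  subst (λ Γ′ → Γ′ ⊢ N ⇐ _) (map-substT-single-renT B Γ) (⇐-substT (single B) D)

⇐-der : ∀ {t k} {Γ : Ctx t k} {N} {σ : Ty 0} {h : NoAllT neg σ} → Γ ⊢ N ⇐ § σ h → Γ ⊢ N ⇐ emb σ
⇐-der (tNeu S) = tNeu (tDer S)
⇐-der (tBox D) = D

⇐-notLam-⇒ : ∀ {t k} {Γ : Ctx t k} {N σ B} → Γ ⊢ N ⇐ lin (σ ⊸ B) → NotLam N → Γ ⊢ N ⇒ lin (σ ⊸ B)
⇐-notLam-⇒ (tNeu S) _ = S

-- Hereditary substitution: ⇐-inst and ⇐-der re-type eliminations of a substituted variable, and
-- normality of the result keeps a λ out of function position.
⇐-substTm : ∀ {t k k′} {Ξ : Ctx t k} {Θ : Ctx t k′} (f : Fin k → Tm k′) {M τ} → Ξ ⊢ M ⇐ τ →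
            (∀ i → 1 ≤ occ i M → Θ ⊢ f i ⇐ lookup Ξ i) → Normal (substTm f M) → Θ ⊢ substTm f M ⇐ τ
⇒-substTm : ∀ {t k k′} {Ξ : Ctx t k} {Θ : Ctx t k′} (f : Fin k → Tm k′) {M τ} → Ξ ⊢ M ⇒ τ →
            (∀ i → 1 ≤ occ i M → Θ ⊢ f i ⇐ lookup Ξ i) → Normal (substTm f M) → Θ ⊢ substTm f M ⇐ τ
⇐-substTm f (tNeu S) h n = ⇒-substTm f S h n
⇐-substTm {Ξ = Ξ} {Θ} f (tLam {σ = σ} {M = M} D) h n = tLam (⇐-substTm (extTm f) D h′ n)
  where
  h′ : ∀ i → 1 ≤ occ i M → (σ ∷ Θ) ⊢ extTm f i ⇐ lookup (σ ∷ Ξ) i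
  h′ zero    _ = tNeu tVar
  h′ (suc i) o = ⇐-renTm suc (λ _ → refl) (h i o)
⇐-substTm {Ξ = Ξ} {Θ} f (tGen {M = M} D) h n = tGen (⇐-substTm f D h′ n)
  where
  h′ : ∀ i → 1 ≤ occ i M → map (renT suc) Θ ⊢ f i ⇐ lookup (map (renT suc) Ξ) i
  h′ i o = subst (λ τ → map (renT suc) Θ ⊢ f i ⇐ τ) (sym (lookup-map i (renT suc) Ξ)) (⇐-renT suc (h i o))
⇐-substTm f (tBox D) h n = tBox (⇐-substTm f D h n)
⇒-substTm f (tVar {i = i}) h _ = h i (≤-reflexive (sym (occ-var-self i)))
⇒-substTm f (tApp {M = M} {P = P} S Q) h (nl , nM , nP) =
  tNeu (tApp (⇐-notLam-⇒ (⇒-substTm f S (λ i o → h i (≤-trans o (m≤m+n (occ i M) (occ i P)))) nM) nl)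
             (⇐-substTm f Q (λ i o → h i (≤-trans o (m≤n+m (occ i P) (occ i M)))) nP))
⇒-substTm f (tInst {B = B} S) h n = ⇐-inst B (⇒-substTm f S h n)
⇒-substTm f (tDer S)          h n = ⇐-der (⇒-substTm f S h n)

lookup-embL : ∀ {t k l m} {Θ : Ctx t k} {Γ : Ctx t l} {Δ : Ctx t m} (s : Split Θ Γ Δ) i →
              lookup Θ (embL s i) ≡ lookup Γ i
lookup-embL (left s)  zero    = refl
lookup-embL (left s)  (suc i) = lookup-embL s i
lookup-embL (right s) i       = lookup-embL s i

lookup-embR : ∀ {t k l m} {Θ : Ctx t k} {Γ : Ctx t l} {Δ : Ctx t m} (s : Split Θ Γ Δ) i →
              lookup Θ (embR s i) ≡ lookup Δ i
lookup-embR (left s)  i       = lookup-embR s i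
lookup-embR (right s) zero    = refl
lookup-embR (right s) (suc i) = lookup-embR s i

⇐-renTm-ins : ∀ {t k m} {Θ : Ctx t k} {ξ υ τ : Ty t} {Γ : Ctx t m} {M} (s : Split Θ (ξ ∷ []) Γ) →
              Θ ⊢ var (embL s zero) ⇒ υ → (υ ∷ Γ) ⊢ M ⇐ τ → Normal (renTm (ins s) M) →
              Θ ⊢ renTm (ins s) M ⇐ τ
⇐-renTm-ins {Θ = Θ} {τ = τ} {M = M} s x D n =
  subst (λ X → Θ ⊢ X ⇐ τ) (sym (renTm≡substTm (ins s) M))
        (⇐-substTm (var ∘ ins s) D h (subst Normal (renTm≡substTm (ins s) M) n))
  where
  h : ∀ i → 1 ≤ occ i M → Θ ⊢ var (ins s i) ⇐ lookup (_ ∷ _) i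
  h zero    _ = tNeu x
  h (suc i) _ = tNeu (tVar′ (lookup-embR s i))

⊢-pure-normal-⇐ : ∀ {t k} {Θ : Ctx t k} {M τ} → Θ ⊢ M ∶ τ → Pure M → Normal M → Θ ⊢ M ⇐ τ
⊢-pure-normal-⇐ ax _ _ = tNeu tVar
⊢-pure-normal-⇐ (cut {N = N} {M = M} s D E) p n = ⇐-substTm f (⊢-pure-normal-⇐ E pM nM) h n
  where
  f  = cutSub s N
  pM = pure-substTm⁻ f M p
  nM = normal-substTm⁻ f M pM n
  h : ∀ i → 1 ≤ occ i M → _ ⊢ f i ⇐ lookup (_ ∷ _) i
  h zero o with pure-normal-substTm⁻ f M zero pM o p n
  ... | pN , nN = ⇐-renTm (embL s) (lookup-embL s)
    (⊢-pure-normal-⇐ D (pure-renTm⁻ (embL s) N pN) (normal-renTm⁻ (embL s) N (pure-renTm⁻ (embL s) N pN) nN))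
  h (suc i) _ = tNeu (tVar′ (lookup-embR s i))
⊢-pure-normal-⇐ (⊸R D) p n = tLam (⊢-pure-normal-⇐ D p n)
⊢-pure-normal-⇐ (⊸L {N = N} {M = M} s₁ s₂ D E) p n = ⇐-substTm f (⊢-pure-normal-⇐ E pM nM) h n
  where
  f  = arrSub s₁ s₂ N
  ρN = λ i → embR s₁ (embL s₂ i)
  pM = pure-substTm⁻ f M p
  nM = normal-substTm⁻ f M pM n
  h : ∀ i → 1 ≤ occ i M → _ ⊢ f i ⇐ lookup (_ ∷ _) i
  h zero o with pure-normal-substTm⁻ f M zero pM o p n
  ... | (_ , pN) , (_ , _ , nN) =
    tNeu (tApp (tVar′ (lookup-embL s₁ zero))
      (⇐-renTm ρN (λ i → trans (lookup-embR s₁ (embL s₂ i)) (lookup-embL s₂ i))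
        (⊢-pure-normal-⇐ D (pure-renTm⁻ ρN N pN) (normal-renTm⁻ ρN N (pure-renTm⁻ ρN N pN) nN))))
  h (suc i) _ = tNeu (tVar′ (trans (lookup-embR s₁ (embR s₂ i)) (lookup-embR s₂ i)))
⊢-pure-normal-⇐ (∀R D) p n = tGen (⊢-pure-normal-⇐ D p n)
⊢-pure-normal-⇐ (∀L {M = M} {B = B} s D) p n =
  ⇐-renTm-ins s (tInst {B = B} (tVar′ (lookup-embL s zero)))
              (⊢-pure-normal-⇐ D pM (normal-renTm⁻ (ins s) M pM n)) n
  where pM = pure-renTm⁻ (ins s) M p
⊢-pure-normal-⇐ (prom _ D) p n = tBox (⊢-pure-normal-⇐ D p n)
⊢-pure-normal-⇐ (der {M = M} s D) p n =
  ⇐-renTm-ins s (tDer (tVar′ (lookup-embL s zero)))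
              (⊢-pure-normal-⇐ D pM (normal-renTm⁻ (ins s) M pM n)) n
  where pM = pure-renTm⁻ (ins s) M p
⊢-pure-normal-⇐ (weak s D) () _
⊢-pure-normal-⇐ (cntr s D v E) () _

usedSize : ∀ {t k} → Ctx t k → Tm k → ℕ
usedSize Γ M = ∑ (λ i → occ i M * tsize (lookup Γ i))

usedSize-var : ∀ {t k} (Γ : Ctx t k) i → usedSize Γ (var i) ≡ tsize (lookup Γ i)
usedSize-var Γ i = ∑-occ-var-* i (tsize ∘ lookup Γ)

usedSize-app : ∀ {t k} (Γ : Ctx t k) M P → usedSize Γ (app M P) ≡ usedSize Γ M + usedSize Γ P
usedSize-app Γ M P = ∑-occ-app M P (tsize ∘ lookup Γ)

usedSize-renT : ∀ {t t′ k} (ρ : Fin t → Fin t′) (Γ : Ctx t k) M → usedSize (map (renT ρ) Γ) M ≡ usedSize Γ M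
usedSize-renT ρ Γ M =
  sum-cong-≗ (λ i → cong (occ i M *_) (trans (cong tsize (lookup-map i (renT ρ) Γ)) (tsize-renT ρ (lookup Γ i))))

usedSize-linear : ∀ {t k} (Γ : Ctx t k) M → (∀ i → occ i M ≡ 1) → usedSize Γ M ≡ sum (map tsize Γ)
usedSize-linear Γ M once =
  trans (sum-cong-≗ (λ i → trans (cong (_* tsize (lookup Γ i)) (once i)) (*-identityˡ _)))
        (sym (sum-map≡∑-lookup tsize Γ))

lsize≥1 : ∀ {t} (A : LTy t) → 1 ≤ lsize A
lsize≥1 (tv i)  = s≤s z≤n
lsize≥1 (σ ⊸ A) = s≤s z≤n
lsize≥1 (Π A)   = s≤s z≤n

tsize≥1 : ∀ {t} (σ : Ty t) → 1 ≤ tsize σ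
tsize≥1 (lin A) = lsize≥1 A
tsize≥1 (§ σ h) = s≤s z≤n

-- Synthesised types have no positive ∀, so eliminations only peel off ⊸ and §, and every node of
-- the term is paid for by a node of a used hypothesis or of the checked type.
⇒-size : ∀ {t k} {Γ : Ctx t k} {M C} → Γ ⊢ M ⇒ C → All (NoAllT pos) Γ → LamLinear M →
         NoAllT pos C × (tmsize M + tsize C ≤ usedSize Γ M + 1)
⇐-size : ∀ {t k} {Γ : Ctx t k} {M τ} → Γ ⊢ M ⇐ τ → All (NoAllT pos) Γ → NoAllT neg τ → LamLinear M →
         tmsize M ≤ usedSize Γ M + tsize τ
⇒-size {Γ = Γ} (tVar {i = i}) lz _ =
  lookup⁺ lz i , ≤-reflexive (trans (+-comm 1 (tsize (lookup Γ i))) (cong (_+ 1) (sym (usedSize-var Γ i))))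
⇒-size {Γ = Γ} (tApp {M = M} {P = P} {σ = σ} {B = B} S Q) lz (lM , lP) with ⇒-size S lz lM
... | lin (a ⊸ b) , bound-M = lin b , +-cancelʳ-≤ (tsize σ) _ _ (begin
  suc (tmsize M + tmsize P) + lsize B + tsize σ    ≡⟨ rearrange (tmsize M) (tmsize P) (tsize σ) (lsize B) ⟩
  tmsize M + suc (tsize σ + lsize B) + tmsize P    ≤⟨ +-mono-≤ bound-M (⇐-size Q lz a lP) ⟩
  usedSize Γ M + 1 + (usedSize Γ P + tsize σ)      ≡⟨ regroup (usedSize Γ M) (usedSize Γ P) (tsize σ) ⟩
  usedSize Γ M + usedSize Γ P + 1 + tsize σ        ≡⟨ cong (λ w → w + 1 + tsize σ) (usedSize-app Γ M P) ⟨
  usedSize Γ (app M P) + 1 + tsize σ               ∎)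
  where
  open ≤-Reasoning
  rearrange : ∀ m p a b → suc (m + p) + b + a ≡ m + suc (a + b) + p
  rearrange = solve-∀
  regroup : ∀ x y a → x + 1 + (y + a) ≡ x + y + 1 + a
  regroup = solve-∀
⇒-size (tInst S) lz l with ⇒-size S lz l
... | lin () , _
⇒-size {Γ = Γ} {M = M} (tDer {σ = σ} S) lz l with ⇒-size S lz l
... | § p , bound = noAll-renT (λ ()) p , (begin
  tmsize M + tsize (emb σ)    ≡⟨ cong (tmsize M +_) (tsize-renT (λ ()) σ) ⟩
  tmsize M + tsize σ          ≤⟨ +-monoʳ-≤ (tmsize M) (n≤1+n (tsize σ)) ⟩
  tmsize M + suc (tsize σ)    ≤⟨ bound ⟩
  usedSize Γ M + 1            ∎)
  where open ≤-Reasoning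
⇐-size {Γ = Γ} {τ = τ} (tNeu {M = M} S) lz _ l =
  ≤-trans (+-cancelʳ-≤ 1 _ _ (≤-trans (+-monoʳ-≤ (tmsize M) (tsize≥1 τ)) (proj₂ (⇒-size S lz l))))
          (m≤m+n (usedSize Γ M) (tsize τ))
⇐-size {Γ = Γ} (tLam {σ = σ} {M = M} {B = B} D) lz (lin (a ⊸ b)) (once , l) = begin
  suc (tmsize M)                          ≤⟨ s≤s (⇐-size D (a ∷ lz) (lin b) l) ⟩
  suc (occ zero M * tsize σ + w + lsize B) ≡⟨ cong (λ o → suc (o * tsize σ + w + lsize B)) once ⟩
  suc (1 * tsize σ + w + lsize B)          ≡⟨ rearrange (tsize σ) w (lsize B) ⟩
  w + suc (tsize σ + lsize B)              ∎
  where
  open ≤-Reasoning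
  w = usedSize Γ (lam M)
  rearrange : ∀ a w b → suc (1 * a + w + b) ≡ w + suc (a + b)
  rearrange = solve-∀
⇐-size {Γ = Γ} (tGen {M = M} {A = A} D) lz (lin (Π a)) l = begin
  tmsize M                                         ≤⟨ ⇐-size D (noAll-renT-map suc lz) (lin a) l ⟩
  usedSize (map (renT suc) Γ) M + lsize A          ≡⟨ cong (_+ lsize A) (usedSize-renT suc Γ M) ⟩
  usedSize Γ M + lsize A                           ≤⟨ +-monoʳ-≤ (usedSize Γ M) (n≤1+n (lsize A)) ⟩
  usedSize Γ M + suc (lsize A)                     ∎
  where open ≤-Reasoning
⇐-size {Γ = Γ} (tBox {M = M} {σ = σ} D) lz (§ h) l = begin
  tmsize M                       ≤⟨ ⇐-size D lz (noAll-renT (λ ()) h) l ⟩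
  usedSize Γ M + tsize (emb σ)   ≡⟨ cong (usedSize Γ M +_) (tsize-renT (λ ()) σ) ⟩
  usedSize Γ M + tsize σ         ≤⟨ +-monoʳ-≤ (usedSize Γ M) (n≤1+n (tsize σ)) ⟩
  usedSize Γ M + suc (tsize σ)   ∎
  where open ≤-Reasoning

⊢-lazy-size : ∀ {t k} {Γ : Ctx t k} {M τ} → Γ ⊢ M ∶ τ → Pure M → Normal M → LamLinear M →
              All (NoAllT pos) Γ → NoAllT neg τ → tmsize M ≤ usedSize Γ M + tsize τ
⊢-lazy-size D p n l lz lτ = ⇐-size (⊢-pure-normal-⇐ D p n) lz lτ l

pureTerms : (k n : ℕ) → List (Tm k)
pureTerms k zero    = List.[]
pureTerms k (suc n) = List.map var (List.allFin k)
              List.++ (List.map lam (pureTerms (suc k) n)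
              List.++ List.cartesianProductWith app (pureTerms k n) (pureTerms k n))

pureTerms-complete : ∀ {k} n (M : Tm k) → Pure M → tmsize M ≤ n → M ∈ pureTerms k n
pureTerms-complete (suc n) (var i)   _ _       = ∈-++⁺ˡ (∈-map⁺ var (∈-allFin i))
pureTerms-complete {k} (suc n) (lam M) p (s≤s h) =
  ∈-++⁺ʳ (List.map var (List.allFin k)) (∈-++⁺ˡ (∈-map⁺ lam (pureTerms-complete n M p h)))
pureTerms-complete {k} (suc n) (app M N) (p , q) (s≤s h) =
  ∈-++⁺ʳ (List.map var (List.allFin k)) (∈-++⁺ʳ (List.map lam (pureTerms (suc k) n))
    (∈-cartesianProductWith⁺ app (pureTerms-complete n M p (≤-trans (m≤m+n _ _) h))
                                 (pureTerms-complete n N q (≤-trans (m≤n+m _ _) h))))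

lemma5p7 : ∀ {t k} {Γ : Ctx t k} {M : Tm k} {σ : Ty t}
    (D : Γ ⊢ M ∶ σ) → CutFree D → LazyJ Γ σ →
    ((Pure M × Normal M × Linear M)
    × (tmsize M ≤ sum (map tsize Γ) + tsize σ)
    × (dsize D ≡ tmsize M + (sum (map tquant Γ) + tquant σ))
    × (∀ {N : Tm k} (D′ : Γ ⊢ N ∶ σ) → CutFree D′ → LazyJ Γ σ →
         tmsize N ≤ tmsize M → dsize D′ ≤ dsize D)
    × ∃ (λ (L : List (Tm 0)) →
         ∀ (V : Tm 0) → IsValue V → [] ⊢ V ∶ σ → V ∈ L))
lemma5p7 {Γ = Γ} {M} {σ} D cf (lz , lσ) with cutFree-lazy D cf lz lσ
... | lnM , dsize≡ =
  (pure lnM , normal lnM , (≤-reflexive ∘ occ≡1 lnM , lamLinear lnM)) ,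
  subst (λ w → tmsize M ≤ w + tsize σ) (usedSize-linear Γ M (occ≡1 lnM))
        (⊢-lazy-size D (pure lnM) (normal lnM) (lamLinear lnM) lz lσ) ,
  dsize≡ ,
  shorter ,
  pureTerms 0 (tsize σ) , λ V (pV , nV , _ , lV) DV →
    pureTerms-complete (tsize σ) V pV (⊢-lazy-size DV pV nV lV [] lσ)
  where
  shorter : ∀ {N} (D′ : Γ ⊢ N ∶ σ) → CutFree D′ → LazyJ Γ σ → tmsize N ≤ tmsize M → dsize D′ ≤ dsize D
  shorter {N} D′ cf′ _ N≤M = begin
    dsize D′                 ≡⟨ proj₂ (cutFree-lazy D′ cf′ lz lσ) ⟩
    tmsize N + quant Γ σ     ≤⟨ +-monoˡ-≤ (quant Γ σ) N≤M ⟩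
    tmsize M + quant Γ σ     ≡⟨ dsize≡ ⟨
    dsize D                  ∎
    where open ≤-Reasoning
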